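{- Let $p$ be a prime number, $G'$ a finite group of order prime to $p$, $H'$ a subgroup of $G'$, $V$ a 2-dimensional $\mathbb{F}_p$-representation of $G'$, and $L$ a 1-dimensional subspace of $V$ fixed (as a set) by $H'$. Let $G:=V\rtimes G'$, $H:=L\rtimes H'$ and $S_p:=V\rtimes\{1\}$. Then $V$ satisfies conditions (B) and (C) if and only if $G$, $H$, $S_p$ satisfy (b) $[S_p,G]=S_p$ and (c) $N_G(S_p\cap H)=Z_G(S_p\cap H)$.
   Context: Condition (B): $V^{G'}=\{0\}$. Condition (C): the stabilizer of $L$ in $G'$ acts trivially on $L$. $[S_p,G]$ is the subgroup generated by $sgs^{ -1}g^{ -1}$ for $s\in S_p$, $g\in G$; $N_G$ and $Z_G$ denote normalizer and centralizer. -}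

module Defs where

open import Level using (Level; _⊔_)
open import Data.Nat using (ℕ)
open import Data.Nat.Primality using (Prime)
open import Data.Nat.Coprimality using (Coprime)
open import Data.Fin using (Fin)
open import Data.Integer using (ℤ; +_; _+_; _*_; _-_; -_)
open import Data.Integer.Divisibility using (_∣_)
open import Data.Product using (Σ; ∃; ∃-syntax; _×_; _,_)
open import Relation.Nullary using (¬_)
open import Relation.Binary.PropositionalEquality using (_≡_)
open import Algebra.Bundles using (Group)

-- The prime field F_p, modelled as ℤ with equality "congruent mod p".

_≈[_]_ : ℤ → ℕ → ℤ → Set
a ≈[ p ] b = (+ p) ∣ (a - b)

-- V = F_p²  (pairs of integers, read mod p)
record Vec2 : Set where
  constructor vec
  field
    x₁ x₂ : ℤ
open Vec2 public

record Mat2 : Set where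
  constructor mat
  field
    a b c d : ℤ
open Mat2 public

module Fp (p : ℕ) where

  _≈V_ : Vec2 → Vec2 → Set
  u ≈V v = (x₁ u ≈[ p ] x₁ v) × (x₂ u ≈[ p ] x₂ v)

  _≈M_ : Mat2 → Mat2 → Set
  M ≈M N = (a M ≈[ p ] a N) × (b M ≈[ p ] b N) × (c M ≈[ p ] c N) × (d M ≈[ p ] d N)

  0V : Vec2
  0V = vec (+ 0) (+ 0)

  _+V_ : Vec2 → Vec2 → Vec2
  u +V v = vec (x₁ u + x₁ v) (x₂ u + x₂ v)

  -V_ : Vec2 → Vec2
  -V u = vec (- x₁ u) (- x₂ u)

  _·V_ : ℤ → Vec2 → Vec2
  k ·V u = vec (k * x₁ u) (k * x₂ u)

  _⊛_ : Mat2 → Vec2 → Vec2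
  M ⊛ u = vec (a M * x₁ u + b M * x₂ u) (c M * x₁ u + d M * x₂ u)

  _*M_ : Mat2 → Mat2 → Mat2
  M *M N = mat (a M * a N + b M * c N) (a M * b N + b M * d N)
               (c M * a N + d M * c N) (c M * b N + d M * d N)

  IM : Mat2
  IM = mat (+ 1) (+ 0) (+ 0) (+ 1)

module _ {c ℓ : Level} (G : Group c ℓ) where
  open Group G

  HasOrder : ℕ → Set (c ⊔ ℓ)
  HasOrder n = Σ (Fin n → Carrier) λ e →
    (∀ x → ∃[ i ] (e i ≈ x)) × (∀ i j → e i ≈ e j → i ≡ j)

  record IsSubgroup {q : Level} (P : Carrier → Set q) : Set (c ⊔ ℓ ⊔ q) where
    field
      resp  : ∀ {x y} → x ≈ y → P x → P y
      ε∈    : P ε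
      ∙∈    : ∀ {x y} → P x → P y → P (x ∙ y)
      ⁻¹∈   : ∀ {x} → P x → P (x ⁻¹)

  record IsRep2 (p : ℕ) (ρ : Carrier → Mat2) : Set (c ⊔ ℓ) where
    open Fp p
    field
      resp : ∀ {x y} → x ≈ y → ρ x ≈M ρ y
      hom  : ∀ x y → ρ (x ∙ y) ≈M (ρ x *M ρ y)
      unit : ρ ε ≈M IM

module Setting {c ℓ : Level} (G' : Group c ℓ) (p : ℕ)
               (ρ : Group.Carrier G' → Mat2) (l : Vec2) where
  open Group G' renaming (Carrier to C; _∙_ to _∙'_; ε to ε'; _⁻¹ to _⁻¹'; _≈_ to _≈'_)
  open Fp p

  InL : Vec2 → Set
  InL v = ∃[ k ] (v ≈V (k ·V l))

  Stabilizes : C → Set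
  Stabilizes g = (∀ v → InL v → InL (ρ g ⊛ v))
               × (∀ w → InL w → ∃[ v ] (InL v × ((ρ g ⊛ v) ≈V w)))

  CondB : Set c
  CondB = ∀ v → (∀ g → (ρ g ⊛ v) ≈V v) → v ≈V 0V

  CondC : Set c
  CondC = ∀ g → Stabilizes g → ∀ v → InL v → (ρ g ⊛ v) ≈V v

  Elem : Set c
  Elem = Vec2 × C

  _≈G_ : Elem → Elem → Set ℓ
  (v , g) ≈G (w , h) = (v ≈V w) × (g ≈' h)

  _∙G_ : Elem → Elem → Elem
  (v , g) ∙G (w , h) = (v +V (ρ g ⊛ w)) , (g ∙' h)

  _⁻¹G : Elem → Elem
  (v , g) ⁻¹G = (-V (ρ (g ⁻¹') ⊛ v)) , (g ⁻¹')

  εG : Elem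
  εG = 0V , ε'

  InSp : Elem → Set ℓ
  InSp (v , g) = g ≈' ε'

  data Gen {q : Level} (P : Elem → Set q) : Elem → Set (c ⊔ ℓ ⊔ q) where
    gen  : ∀ {x} → P x → Gen P x
    one  : Gen P εG
    mul  : ∀ {x y} → Gen P x → Gen P y → Gen P (x ∙G y)
    inv  : ∀ {x} → Gen P x → Gen P (x ⁻¹G)
    resp : ∀ {x y} → x ≈G y → Gen P x → Gen P y

  IsComm : Elem → Set (c ⊔ ℓ)
  IsComm x = ∃[ s ] ∃[ g ] (InSp s × (x ≈G (((s ∙G g) ∙G (s ⁻¹G)) ∙G (g ⁻¹G))))

  Condb : Set (c ⊔ ℓ)
  Condb = ∀ x → (InSp x → Gen IsComm x) × (Gen IsComm x → InSp x)

  module _ {q : Level} (H' : C → Set q) where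
    InH : Elem → Set q
    InH (v , h) = InL v × H' h

    InK : Elem → Set (ℓ ⊔ q)
    InK x = InSp x × InH x

    InN : Elem → Set (c ⊔ ℓ ⊔ q)
    InN g = (∀ k → InK k → InK ((g ∙G k) ∙G (g ⁻¹G)))
          × (∀ k → InK k → ∃[ k' ] (InK k' × (((g ∙G k') ∙G (g ⁻¹G)) ≈G k)))

    InZ : Elem → Set (c ⊔ ℓ ⊔ q)
    InZ g = ∀ k → InK k → (g ∙G k) ≈G (k ∙G g)

    Condc : Set (c ⊔ ℓ ⊔ q)
    Condc = ∀ g → (InN g → InZ g) × (InZ g → InN g)

-- The orbit sum N v = Σ_{g ∈ G'} g·v is G'-invariant, and (v , g) ↦ N v is a homomorphism from G
-- to the abelian group V, so it vanishes on [S_p, G]. Under (b) every v ∈ V^{G'} lies in [S_p, G],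
-- hence 0 = N v = n·v, and v = 0 because n = |G'| is invertible mod p. Conversely, under (B) every
-- N w vanishes, so writing v = n·w gives v = Σ_g (w − g·w), a product of the commutators
-- [(w , 1) , (0 , g)]; and [S_p, G] ⊆ S_p always holds.
--
-- Conjugating (u , 1) ∈ S_p ∩ H = L ⋊ 1 by (w , h) gives (h·u , 1). Hence (w , h) normalizes S_p ∩ H
-- iff h stabilizes L, and centralizes it iff h fixes L pointwise, so (c) says exactly (C).

module Submission where

open import Defs
open import Level using (Level; _⊔_; 0ℓ)
open import Data.Nat as ℕ using (ℕ)
import Data.Nat.Properties as ℕ
open import Data.Nat.Primality using (Prime)
open import Data.Nat.Coprimality using (Coprime; coprime-Bézout)
open import Data.Nat.GCD using (module Bézout)
open import Data.Integer using (ℤ; +_; _+_; _*_; _-_; -_)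
import Data.Integer.Properties as ℤ
import Data.Integer.Divisibility.Signed as ℤ∣
open import Data.Integer.Tactic.RingSolver using (solve-∀)
open import Data.Fin as Fin using (Fin)
open import Data.Fin.Permutation using (Permutation; permutation; _⟨$⟩ʳ_)
open import Data.Product using (Σ; _×_; _,_; proj₁; proj₂; ∃-syntax)
open import Data.Product.Function.NonDependent.Propositional using (_×-⇔_)
open import Function.Base using (_∘_)
open import Function.Bundles using (_⇔_; mk⇔; Equivalence)
open import Relation.Nullary using (¬_)
open import Relation.Binary.PropositionalEquality as ≡ using (_≡_; refl; module ≡-Reasoning)
import Relation.Binary.Reasoning.Setoid as SetoidReasoning
open import Algebra.Bundles using (Group; AbelianGroup; Monoid)
open import Algebra.Morphism.Structures using (IsMagmaHomomorphism; IsMonoidHomomorphism; IsGroupHomomorphism)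
import Algebra.Properties.Group as GroupProperties
import Algebra.Properties.AbelianGroup as AbelianGroupProperties
import Algebra.Properties.Monoid.Sum as MonoidSum
import Algebra.Properties.CommutativeMonoid.Sum as CommutativeMonoidSum

module _ {a b ℓa ℓb} (A : Group a ℓa) (B : Group b ℓb) where
  private
    module A = Group A
    module B = Group B

  ∙-homo⇒isGroupHomomorphism : ∀ {f} → IsMagmaHomomorphism A.rawMagma B.rawMagma f →
                               IsGroupHomomorphism A.rawGroup B.rawGroup f
  ∙-homo⇒isGroupHomomorphism {f} isMagmaHomomorphism = record
    { isMonoidHomomorphism = record { isMagmaHomomorphism = isMagmaHomomorphism ; ε-homo = ε-homo }
    ; ⁻¹-homo = ⁻¹-homo
    }
    where
    open IsMagmaHomomorphism isMagmaHomomorphism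
    open B using (_≈_; _∙_; _⁻¹; ε)
    open GroupProperties B using (identityˡ-unique; inverseˡ-unique)
    open SetoidReasoning B.setoid

    ε-homo : f A.ε ≈ ε
    ε-homo = identityˡ-unique (f A.ε) (f A.ε) (begin
      f A.ε ∙ f A.ε    ≈⟨ homo A.ε A.ε ⟨
      f (A.ε A.∙ A.ε)  ≈⟨ ⟦⟧-cong (A.identityˡ A.ε) ⟩
      f A.ε            ∎)

    ⁻¹-homo : ∀ x → f (x A.⁻¹) ≈ f x ⁻¹
    ⁻¹-homo x = inverseˡ-unique (f (x A.⁻¹)) (f x) (begin
      f (x A.⁻¹) ∙ f x    ≈⟨ homo (x A.⁻¹) x ⟨
      f (x A.⁻¹ A.∙ x)    ≈⟨ ⟦⟧-cong (A.inverseˡ x) ⟩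
      f A.ε               ≈⟨ ε-homo ⟩
      ε                   ∎)

module _ {a b ℓa ℓb} (M : Monoid a ℓa) (N : Monoid b ℓb) where
  private
    module M = Monoid M
    module N = Monoid N

  ∑-homo : ∀ {f} → IsMonoidHomomorphism M.rawMonoid N.rawMonoid f →
           ∀ {n} (g : Fin n → M.Carrier) → f (MonoidSum.sum M g) N.≈ MonoidSum.sum N (f ∘ g)
  ∑-homo isMonoidHomomorphism {ℕ.zero} g = ε-homo
    where open IsMonoidHomomorphism isMonoidHomomorphism
  ∑-homo isMonoidHomomorphism {ℕ.suc n} g = N.trans
    (homo (g Fin.zero) (MonoidSum.sum M (g ∘ Fin.suc)))
    (N.∙-congˡ (∑-homo isMonoidHomomorphism (g ∘ Fin.suc)))
    where open IsMonoidHomomorphism isMonoidHomomorphism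

record IsLinearAction {c ℓ a ℓa} (G : Group c ℓ) (A : AbelianGroup a ℓa)
                      (act : Group.Carrier G → AbelianGroup.Carrier A → AbelianGroup.Carrier A)
                      : Set (c ⊔ ℓ ⊔ a ⊔ ℓa) where
  private
    module G = Group G
    module A = AbelianGroup A
  field
    act-cong     : ∀ {g h u v} → g G.≈ h → u A.≈ v → act g u A.≈ act h v
    act-identity : ∀ u → act G.ε u A.≈ u
    act-∙        : ∀ g h u → act (g G.∙ h) u A.≈ act g (act h u)
    act-+        : ∀ g u v → act g (u A.∙ v) A.≈ act g u A.∙ act g v

  act-isGroupHomomorphism : ∀ g → IsGroupHomomorphism A.rawGroup A.rawGroup (act g)
  act-isGroupHomomorphism g = ∙-homo⇒isGroupHomomorphism A.group A.group record
    { isRelHomomorphism = record { cong = act-cong G.refl }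
    ; homo = act-+ g
    }

  act-cancel : ∀ g u → act g (act (g G.⁻¹) u) A.≈ u
  act-cancel g u =
    A.trans (A.sym (act-∙ g (g G.⁻¹) u)) (A.trans (act-cong (G.inverseʳ g) A.refl) (act-identity u))

module Enumeration {c ℓ} (G : Group c ℓ) {n} (order : HasOrder G n) where
  open Group G

  enumerate : Fin n → Carrier
  enumerate = proj₁ order

  private
    index : Carrier → Fin n
    index x = proj₁ (proj₁ (proj₂ order) x)

    enumerate-index : ∀ x → enumerate (index x) ≈ x
    enumerate-index x = proj₂ (proj₁ (proj₂ order) x)

    enumerate-injective : ∀ i j → enumerate i ≈ enumerate j → i ≡ j
    enumerate-injective = proj₂ (proj₂ order)

  bijection⇒permutation : (φ ψ : Carrier → Carrier) →
    (∀ {x y} → x ≈ y → φ x ≈ φ y) → (∀ {x y} → x ≈ y → ψ x ≈ ψ y) →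
    (∀ x → φ (ψ x) ≈ x) → (∀ x → ψ (φ x) ≈ x) →
    Σ (Permutation n n) λ σ → ∀ i → enumerate (σ ⟨$⟩ʳ i) ≈ φ (enumerate i)
  bijection⇒permutation φ ψ φ-cong ψ-cong φψ ψφ =
    permutation to from to-from from-to , λ i → enumerate-index (φ (enumerate i))
    where
    to from : Fin n → Fin n
    to i = index (φ (enumerate i))
    from i = index (ψ (enumerate i))

    to-from : ∀ i → to (from i) ≡ i
    to-from i = enumerate-injective _ _
      (trans (enumerate-index _) (trans (φ-cong (enumerate-index _)) (φψ (enumerate i))))

    from-to : ∀ i → from (to i) ≡ i
    from-to i = enumerate-injective _ _
      (trans (enumerate-index _) (trans (ψ-cong (enumerate-index _)) (ψφ (enumerate i))))

module OrbitSum {c ℓ a ℓa} {G : Group c ℓ} {A : AbelianGroup a ℓa} {act}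
                 (linear : IsLinearAction G A act) {n} (order : HasOrder G n) where
  open Group G using (_∙_; _//_) renaming (Carrier to C; _≈_ to _≈ᴳ_)
  open AbelianGroup A using (_≈_; setoid) renaming (Carrier to V)
  open CommutativeMonoidSum (AbelianGroup.commutativeMonoid A)
    using (sum-syntax; sum-cong-≋; ∑-distrib-+; sum-permute)
  open IsLinearAction linear
  open Enumeration G order
  open SetoidReasoning setoid
  private
    module G = Group G
    module GP = GroupProperties G
    module A = AbelianGroup A

  ∑-reindex : (f : C → V) → (∀ {x y} → x ≈ᴳ y → f x ≈ f y) → (φ ψ : C → C) →
    (∀ {x y} → x ≈ᴳ y → φ x ≈ᴳ φ y) → (∀ {x y} → x ≈ᴳ y → ψ x ≈ᴳ ψ y) →
    (∀ x → φ (ψ x) ≈ᴳ x) → (∀ x → ψ (φ x) ≈ᴳ x) →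
    ∑[ i < n ] f (φ (enumerate i)) ≈ ∑[ i < n ] f (enumerate i)
  ∑-reindex f f-cong φ ψ φ-cong ψ-cong φψ ψφ = begin
    ∑[ i < n ] f (φ (enumerate i))          ≈⟨ sum-cong-≋ (λ i → f-cong (G.sym (reindexed i))) ⟩
    ∑[ i < n ] f (enumerate (σ ⟨$⟩ʳ i))     ≈⟨ sum-permute (f ∘ enumerate) σ ⟨
    ∑[ i < n ] f (enumerate i)              ∎
    where
    σ = proj₁ (bijection⇒permutation φ ψ φ-cong ψ-cong φψ ψφ)
    reindexed = proj₂ (bijection⇒permutation φ ψ φ-cong ψ-cong φψ ψφ)

  orbitSum : V → V
  orbitSum v = ∑[ i < n ] act (enumerate i) v

  orbitSum-isGroupHomomorphism : IsGroupHomomorphism A.rawGroup A.rawGroup orbitSum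
  orbitSum-isGroupHomomorphism = ∙-homo⇒isGroupHomomorphism A.group A.group record
    { isRelHomomorphism = record { cong = λ {u} {v} u≈v →
        sum-cong-≋ {x = λ i → act (enumerate i) u} {y = λ i → act (enumerate i) v} (λ i → act-cong G.refl u≈v) }
    ; homo = λ u v → A.trans (sum-cong-≋ {y = λ i → act (enumerate i) u A.∙ act (enumerate i) v}
                                (λ i → act-+ (enumerate i) u v))
                             (∑-distrib-+ (λ i → act (enumerate i) u) (λ i → act (enumerate i) v))
    }

  orbitSum-act : ∀ h v → orbitSum (act h v) ≈ orbitSum v
  orbitSum-act h v = begin
    ∑[ i < n ] act (enumerate i) (act h v)   ≈⟨ sum-cong-≋ (λ i → act-∙ (enumerate i) h v) ⟨
    ∑[ i < n ] act (enumerate i ∙ h) v       ≈⟨ ∑-reindex (λ g → act g v) (λ g≈g' → act-cong g≈g' A.refl)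
                                                  (_∙ h) (_// h) G.∙-congʳ G.∙-congʳ
                                                  (GP.//-rightDividesˡ h) (GP.//-rightDividesʳ h) ⟩
    ∑[ i < n ] act (enumerate i) v           ∎

  act-orbitSum : ∀ h v → act h (orbitSum v) ≈ orbitSum v
  act-orbitSum h v = begin
    act h (∑[ i < n ] act (enumerate i) v)   ≈⟨ ∑-homo A.monoid A.monoid
                                                  (IsGroupHomomorphism.isMonoidHomomorphism (act-isGroupHomomorphism h))
                                                  (λ i → act (enumerate i) v) ⟩
    ∑[ i < n ] act h (act (enumerate i) v)   ≈⟨ sum-cong-≋ (λ i → act-∙ h (enumerate i) v) ⟨
    ∑[ i < n ] act (h ∙ enumerate i) v       ≈⟨ ∑-reindex (λ g → act g v) (λ g≈g' → act-cong g≈g' A.refl)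
                                                  (h ∙_) (h G.\\_) G.∙-congˡ G.∙-congˡ
                                                  (GP.\\-leftDividesˡ h) (GP.\\-leftDividesʳ h) ⟩
    ∑[ i < n ] act (enumerate i) v           ∎

  orbitSum-fixed : ∀ v → (∀ g → act g v ≈ v) → orbitSum v ≈ ∑[ i < n ] v
  orbitSum-fixed v fixed = sum-cong-≋ (λ i → fixed (enumerate i))

module ModularArithmetic (p : ℕ) where

  -- A record rather than _≈[ p ]_ itself: that unfolds to divisibility of an absolute value, from
  -- which Agda cannot infer the two integers compared (likewise for _≃_ below).
  infix 4 _≋_
  record _≋_ (a b : ℤ) : Set where
    constructor ⟨_⟩
    field divides-difference : + p ℤ∣.∣ (a - b)
  open _≋_

  ≈⇒≋ : ∀ {a b} → a ≈[ p ] b → a ≋ b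
  ≈⇒≋ a≈b = ⟨ ℤ∣.∣ᵤ⇒∣ a≈b ⟩

  ≋⇒≈ : ∀ {a b} → a ≋ b → a ≈[ p ] b
  ≋⇒≈ a≋b = ℤ∣.∣⇒∣ᵤ (divides-difference a≋b)

  private
    difference : ∀ {a b x} → x ≡ a - b → + p ℤ∣.∣ x → a ≋ b
    difference refl p∣x = ⟨ p∣x ⟩

  ≡⇒≋ : ∀ {a b} → a ≡ b → a ≋ b
  ≡⇒≋ {a} refl = difference (≡.sym (ℤ.+-inverseʳ a)) (ℤ∣.divides (+ 0) refl)

  ≋-refl : ∀ {a} → a ≋ a
  ≋-refl = ≡⇒≋ refl

  ≋-sym : ∀ {a b} → a ≋ b → b ≋ a
  ≋-sym {a} {b} ⟨ p∣a-b ⟩ = difference (negate a b) (ℤ∣.∣m⇒∣-m p∣a-b)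
    where
    negate : ∀ a b → - (a - b) ≡ b - a
    negate = solve-∀

  ≋-trans : ∀ {a b c} → a ≋ b → b ≋ c → a ≋ c
  ≋-trans {a} {b} {c} ⟨ p∣a-b ⟩ ⟨ p∣b-c ⟩ = difference (telescope a b c) (ℤ∣.∣m∣n⇒∣m+n p∣a-b p∣b-c)
    where
    telescope : ∀ a b c → (a - b) + (b - c) ≡ a - c
    telescope = solve-∀

  +-cong : ∀ {a b c d} → a ≋ b → c ≋ d → a + c ≋ b + d
  +-cong {a} {b} {c} {d} ⟨ p∣a-b ⟩ ⟨ p∣c-d ⟩ = difference (regroup a b c d) (ℤ∣.∣m∣n⇒∣m+n p∣a-b p∣c-d)
    where
    regroup : ∀ a b c d → (a - b) + (c - d) ≡ (a + c) - (b + d)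
    regroup = solve-∀

  -‿cong : ∀ {a b} → a ≋ b → - a ≋ - b
  -‿cong {a} {b} ⟨ p∣a-b ⟩ = difference (negate a b) (ℤ∣.∣m⇒∣-m p∣a-b)
    where
    negate : ∀ a b → - (a - b) ≡ (- a) - (- b)
    negate = solve-∀

  *-cong : ∀ {a b c d} → a ≋ b → c ≋ d → a * c ≋ b * d
  *-cong {a} {b} {c} {d} ⟨ p∣a-b ⟩ ⟨ p∣c-d ⟩ =
    difference (split a b c d) (ℤ∣.∣m∣n⇒∣m+n (ℤ∣.∣n⇒∣m*n a p∣c-d) (ℤ∣.∣m⇒∣m*n d p∣a-b))
    where
    split : ∀ a b c d → a * (c - d) + (a - b) * d ≡ a * c - b * d
    split = solve-∀

  invertible : ∀ {n} → Coprime n p → ∃[ m ] (+ n * m ≋ + 1)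
  invertible {n} coprime with coprime-Bézout coprime
  ... | Bézout.+- x y eq = + x , difference (≡.sym (positive eq)) (ℤ∣.divides (+ y) (ℤ.pos-* y p))
    where
    positive : 1 ℕ.+ y ℕ.* p ≡ x ℕ.* n → + n * + x - + 1 ≡ + (y ℕ.* p)
    positive eq = begin
      + n * + x - + 1           ≡⟨ ≡.cong (_- + 1) (ℤ.pos-* n x) ⟨
      + (n ℕ.* x) - + 1         ≡⟨ ≡.cong (λ k → + k - + 1) (ℕ.*-comm n x) ⟩
      + (x ℕ.* n) - + 1         ≡⟨ ≡.cong (λ k → + k - + 1) eq ⟨
      + (1 ℕ.+ y ℕ.* p) - + 1   ≡⟨⟩
      + (y ℕ.* p)               ∎
      where open ≡-Reasoning
  ... | Bézout.-+ x y eq = - + x , difference (≡.sym (negative eq)) (ℤ∣.∣m⇒∣-m (ℤ∣.divides (+ y) (ℤ.pos-* y p)))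
    where
    negative : 1 ℕ.+ x ℕ.* n ≡ y ℕ.* p → + n * - + x - + 1 ≡ - + (y ℕ.* p)
    negative eq = begin
      + n * - + x - + 1         ≡⟨ rearrange (+ n) (+ x) ⟩
      - (+ 1 + + x * + n)       ≡⟨ ≡.cong (λ k → - (+ 1 + k)) (ℤ.pos-* x n) ⟨
      - + (1 ℕ.+ x ℕ.* n)       ≡⟨ ≡.cong (λ k → - + k) eq ⟩
      - + (y ℕ.* p)             ∎
      where
      open ≡-Reasoning
      rearrange : ∀ a b → a * - b - + 1 ≡ - (+ 1 + b * a)
      rearrange = solve-∀

module ModularVectors (p : ℕ) where
  open Fp p
  open ModularArithmetic p

  infix 4 _≃_
  record _≃_ (u v : Vec2) : Set where
    constructor _,_
    field
      ≃₁ : x₁ u ≋ x₁ v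
      ≃₂ : x₂ u ≋ x₂ v

  ≈V⇒≃ : ∀ {u v} → u ≈V v → u ≃ v
  ≈V⇒≃ (e₁ , e₂) = ≈⇒≋ e₁ , ≈⇒≋ e₂

  ≃⇒≈V : ∀ {u v} → u ≃ v → u ≈V v
  ≃⇒≈V (e₁ , e₂) = ≋⇒≈ e₁ , ≋⇒≈ e₂

  ≡⇒≃ : ∀ {u v} → x₁ u ≡ x₁ v → x₂ u ≡ x₂ v → u ≃ v
  ≡⇒≃ eq₁ eq₂ = ≡⇒≋ eq₁ , ≡⇒≋ eq₂

  Fp² : AbelianGroup 0ℓ 0ℓ
  Fp² = record
    { Carrier = Vec2
    ; _≈_     = _≃_
    ; _∙_     = _+V_
    ; ε       = 0V
    ; _⁻¹     = -V_
    ; isAbelianGroup = record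
      { isGroup = record
        { isMonoid = record
          { isSemigroup = record
            { isMagma = record
              { isEquivalence = record
                { refl  = ≋-refl , ≋-refl
                ; sym   = λ (e₁ , e₂) → ≋-sym e₁ , ≋-sym e₂
                ; trans = λ (e₁ , e₂) (f₁ , f₂) → ≋-trans e₁ f₁ , ≋-trans e₂ f₂
                }
              ; ∙-cong = λ (e₁ , e₂) (f₁ , f₂) → +-cong e₁ f₁ , +-cong e₂ f₂
              }
            ; assoc = λ u v w → ≡⇒≃ (ℤ.+-assoc (x₁ u) (x₁ v) (x₁ w)) (ℤ.+-assoc (x₂ u) (x₂ v) (x₂ w))
            }
          ; identity = (λ u → ≡⇒≃ (ℤ.+-identityˡ (x₁ u)) (ℤ.+-identityˡ (x₂ u)))
                     , (λ u → ≡⇒≃ (ℤ.+-identityʳ (x₁ u)) (ℤ.+-identityʳ (x₂ u)))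
          }
        ; inverse = (λ u → ≡⇒≃ (ℤ.+-inverseˡ (x₁ u)) (ℤ.+-inverseˡ (x₂ u)))
                  , (λ u → ≡⇒≃ (ℤ.+-inverseʳ (x₁ u)) (ℤ.+-inverseʳ (x₂ u)))
        ; ⁻¹-cong = λ (e₁ , e₂) → -‿cong e₁ , -‿cong e₂
        }
      ; comm = λ u v → ≡⇒≃ (ℤ.+-comm (x₁ u) (x₁ v)) (ℤ.+-comm (x₂ u) (x₂ v))
      }
    }

  open AbelianGroup Fp² using (setoid) renaming (refl to ≃-refl; trans to ≃-trans)
  open CommutativeMonoidSum (AbelianGroup.commutativeMonoid Fp²) using (sum-syntax)
  open SetoidReasoning setoid

  ·V-cong : ∀ {k k' u v} → k ≋ k' → u ≃ v → k ·V u ≃ k' ·V v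
  ·V-cong k≋k' (e₁ , e₂) = *-cong k≋k' e₁ , *-cong k≋k' e₂

  ·V-assoc : ∀ k k' v → k ·V (k' ·V v) ≃ (k * k') ·V v
  ·V-assoc k k' v = ≡⇒≃ (≡.sym (ℤ.*-assoc k k' (x₁ v))) (≡.sym (ℤ.*-assoc k k' (x₂ v)))

  ·V-identityˡ : ∀ v → (+ 1) ·V v ≃ v
  ·V-identityˡ v = ≡⇒≃ (ℤ.*-identityˡ (x₁ v)) (ℤ.*-identityˡ (x₂ v))

  ·V-zeroˡ : ∀ v → (+ 0) ·V v ≃ 0V
  ·V-zeroˡ v = ≡⇒≃ (ℤ.*-zeroˡ (x₁ v)) (ℤ.*-zeroˡ (x₂ v))

  ·V-zeroʳ : ∀ k → k ·V 0V ≃ 0V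
  ·V-zeroʳ k = ≡⇒≃ (ℤ.*-zeroʳ k) (ℤ.*-zeroʳ k)

  module _ {n} (coprime : Coprime n p) where

    private
      m : ℤ
      m = proj₁ (invertible coprime)

      n*m≋1 : + n * m ≋ + 1
      n*m≋1 = proj₂ (invertible coprime)

      m*n≋1 : m * + n ≋ + 1
      m*n≋1 = ≋-trans (≡⇒≋ (ℤ.*-comm m (+ n))) n*m≋1

    ·V-surjective : ∀ v → ∃[ w ] ((+ n) ·V w ≃ v)
    ·V-surjective v = m ·V v , (begin
      (+ n) ·V (m ·V v)  ≈⟨ ·V-assoc (+ n) m v ⟩
      (+ n * m) ·V v     ≈⟨ ·V-cong n*m≋1 ≃-refl ⟩
      (+ 1) ·V v         ≈⟨ ·V-identityˡ v ⟩
      v                  ∎)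

    ·V-cancel : ∀ {v} → (+ n) ·V v ≃ 0V → v ≃ 0V
    ·V-cancel {v} nv≃0 = begin
      v                  ≈⟨ ·V-identityˡ v ⟨
      (+ 1) ·V v         ≈⟨ ·V-cong m*n≋1 ≃-refl ⟨
      (m * + n) ·V v     ≈⟨ ·V-assoc m (+ n) v ⟨
      m ·V ((+ n) ·V v)  ≈⟨ ·V-cong (≋-refl {m}) nv≃0 ⟩
      m ·V 0V            ≈⟨ ·V-zeroʳ m ⟩
      0V                 ∎

  ∑-const : ∀ n v → ∑[ i < n ] v ≃ (+ n) ·V v
  ∑-const ℕ.zero    v = ·V-zeroˡ v
  ∑-const (ℕ.suc n) v = begin
    v +V (∑[ i < n ] v)    ≈⟨ AbelianGroup.∙-congˡ Fp² {x = v} (∑-const n v) ⟩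
    v +V ((+ n) ·V v)      ≈⟨ ≡⇒≃ (≡.sym (ℤ.suc-* (+ n) (x₁ v))) (≡.sym (ℤ.suc-* (+ n) (x₂ v))) ⟩
    (+ ℕ.suc n) ·V v       ∎

  ⊛-cong : ∀ M N {u v} → M ≈M N → u ≃ v → M ⊛ u ≃ N ⊛ v
  ⊛-cong M N (a≈ , b≈ , c≈ , d≈) (e₁ , e₂) =
      +-cong (*-cong (≈⇒≋ {a M} {a N} a≈) e₁) (*-cong (≈⇒≋ {b M} {b N} b≈) e₂)
    , +-cong (*-cong (≈⇒≋ {c M} {c N} c≈) e₁) (*-cong (≈⇒≋ {d M} {d N} d≈) e₂)

  ⊛-*M : ∀ M N u → (M *M N) ⊛ u ≃ M ⊛ (N ⊛ u)
  ⊛-*M (mat a b c d) (mat e f g h) (vec x y) = ≡⇒≃ (expand a b e f g h x y) (expand c d e f g h x y)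
    where
    expand : ∀ a b e f g h x y →
             (a * e + b * g) * x + (a * f + b * h) * y ≡ a * (e * x + f * y) + b * (g * x + h * y)
    expand = solve-∀

  IM-⊛ : ∀ u → IM ⊛ u ≃ u
  IM-⊛ (vec x y) = ≡⇒≃ (first x y) (second x y)
    where
    first : ∀ x y → + 1 * x + + 0 * y ≡ x
    first = solve-∀
    second : ∀ x y → + 0 * x + + 1 * y ≡ y
    second = solve-∀

  ⊛-+V : ∀ M u v → M ⊛ (u +V v) ≃ (M ⊛ u) +V (M ⊛ v)
  ⊛-+V (mat a b c d) (vec x y) (vec z w) = ≡⇒≃ (distribute a b x y z w) (distribute c d x y z w)
    where
    distribute : ∀ a b x y z w → a * (x + z) + b * (y + w) ≡ (a * x + b * y) + (a * z + b * w)
    distribute = solve-∀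

  isRep2⇒isLinearAction : ∀ {c ℓ} {G : Group c ℓ} {ρ} → IsRep2 G p ρ → IsLinearAction G Fp² (λ g v → ρ g ⊛ v)
  isRep2⇒isLinearAction {G = G} {ρ} rep = record
    { act-cong     = λ {g} {h} g≈h u≃v → ⊛-cong (ρ g) (ρ h) (resp g≈h) u≃v
    ; act-identity = λ u → ≃-trans (⊛-cong (ρ ε) IM unit ≃-refl) (IM-⊛ u)
    ; act-∙        = λ g h u → ≃-trans (⊛-cong (ρ (g ∙ h)) (ρ g *M ρ h) (hom g h) ≃-refl) (⊛-*M (ρ g) (ρ h) u)
    ; act-+        = λ g → ⊛-+V (ρ g)
    }
    where
    open IsRep2 rep
    open Group G using (ε; _∙_)

module SemidirectProduct {c ℓ} (G' : Group c ℓ) (p : ℕ) {ρ} (rep : IsRep2 G' p ρ) (l : Vec2) where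
  open Setting G' p ρ l
  open Fp p
  open ModularVectors p
  open Group G' using (_∙_; _⁻¹; ε) renaming (Carrier to C; _≈_ to _≈ᴳ_)
  open CommutativeMonoidSum (AbelianGroup.commutativeMonoid Fp²) using (sum-syntax; sum-cong-≋; ∑-distrib-+)
  private
    module G = Group G'
    module GP = GroupProperties G'
    module V = AbelianGroup Fp²
    module VP = AbelianGroupProperties Fp²

  act : C → Vec2 → Vec2
  act g v = ρ g ⊛ v

  linear : IsLinearAction G' Fp² act
  linear = isRep2⇒isLinearAction rep

  open IsLinearAction linear using (act-cong; act-identity; act-cancel; act-isGroupHomomorphism)

  act-congˡ : ∀ {g h} v → g ≈ᴳ h → act g v ≃ act h v
  act-congˡ v g≈h = act-cong g≈h (V.refl {v})

  act-congʳ : ∀ g {u v} → u ≃ v → act g u ≃ act g v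
  act-congʳ g = act-cong (G.refl {g})

  act-0 : ∀ g → act g 0V ≃ 0V
  act-0 g = IsGroupHomomorphism.ε-homo (act-isGroupHomomorphism g)

  act-neg : ∀ g v → act g (-V v) ≃ -V act g v
  act-neg g = IsGroupHomomorphism.⁻¹-homo (act-isGroupHomomorphism g)

  ≈G-intro : ∀ {u v g h} → u ≃ v → g ≈ᴳ h → (u , g) ≈G (v , h)
  ≈G-intro u≃v g≈h = ≃⇒≈V u≃v , g≈h

  ≈G⇒≃ : ∀ x y → x ≈G y → proj₁ x ≃ proj₁ y
  ≈G⇒≃ x y x≈y = ≈V⇒≃ (proj₁ x≈y)

  ≈G-sym : ∀ x y → x ≈G y → y ≈G x
  ≈G-sym x y x≈y = ≈G-intro (V.sym (≈G⇒≃ x y x≈y)) (G.sym (proj₂ x≈y))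

  Gen-+V : ∀ {q} {P : Elem → Set q} u v → Gen P (u , ε) → Gen P (v , ε) → Gen P (u +V v , ε)
  Gen-+V u v u∈ v∈ = resp (≈G-intro (V.∙-congˡ {x = u} (act-identity v)) (G.identityˡ ε)) (mul u∈ v∈)

  Gen-∑ : ∀ {q} {P : Elem → Set q} {k} (f : Fin k → Vec2) → (∀ i → Gen P (f i , ε)) → Gen P (∑[ i < k ] f i , ε)
  Gen-∑ {k = ℕ.zero}  f f∈ = one
  Gen-∑ {k = ℕ.suc k} f f∈ = Gen-+V (f Fin.zero) _ (f∈ Fin.zero) (Gen-∑ (f ∘ Fin.suc) (f∈ ∘ Fin.suc))

  commutator : Elem → Elem → Elem
  commutator s g = ((s ∙G g) ∙G (s ⁻¹G)) ∙G (g ⁻¹G)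

  commutator-InSp : ∀ s g → InSp s → InSp (commutator s g)
  commutator-InSp (v , gs) (w , h) gs≈ε = begin
    ((gs ∙ h) ∙ gs ⁻¹) ∙ h ⁻¹   ≈⟨ G.∙-congʳ (G.∙-cong (G.∙-congʳ gs≈ε) (G.trans (G.⁻¹-cong gs≈ε) GP.ε⁻¹≈ε)) ⟩
    ((ε ∙ h) ∙ ε) ∙ h ⁻¹        ≈⟨ G.∙-congʳ (G.trans (G.identityʳ (ε ∙ h)) (G.identityˡ h)) ⟩
    h ∙ h ⁻¹                    ≈⟨ G.inverseʳ h ⟩
    ε                           ∎
    where open SetoidReasoning G.setoid

  Gen-commutator⇒InSp : ∀ {x} → Gen IsComm x → InSp x
  Gen-commutator⇒InSp (gen (s , g , s∈Sp , x≈[s,g])) = G.trans (proj₂ x≈[s,g]) (commutator-InSp s g s∈Sp)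
  Gen-commutator⇒InSp one = G.refl
  Gen-commutator⇒InSp (mul x∈ y∈) =
    G.trans (G.∙-cong (Gen-commutator⇒InSp x∈) (Gen-commutator⇒InSp y∈)) (G.identityˡ ε)
  Gen-commutator⇒InSp (inv x∈) = G.trans (G.⁻¹-cong (Gen-commutator⇒InSp x∈)) GP.ε⁻¹≈ε
  Gen-commutator⇒InSp (resp x≈y x∈) = G.trans (G.sym (proj₂ x≈y)) (Gen-commutator⇒InSp x∈)

  difference-commutator : ∀ w h → IsComm (w +V (-V act h w) , ε)
  difference-commutator w h = (w , ε) , (0V , h) , G.refl ,
    ≈G-intro (V.sym commutator≃difference) (G.sym (commutator-InSp (w , ε) (0V , h) G.refl))
    where
    open SetoidReasoning V.setoid

    ε⁻¹-acts-trivially : act (ε ⁻¹) w ≃ w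
    ε⁻¹-acts-trivially = V.trans (act-congˡ w GP.ε⁻¹≈ε) (act-identity w)

    vanishes : ∀ g → act g (-V act (h ⁻¹) 0V) ≃ 0V
    vanishes g = V.trans (act-congʳ g (V.trans (V.⁻¹-cong (act-0 (h ⁻¹))) VP.ε⁻¹≈ε)) (act-0 g)

    commutator≃difference : proj₁ (commutator (w , ε) (0V , h)) ≃ w +V (-V act h w)
    commutator≃difference = begin
      ((w +V act ε 0V) +V act (ε ∙ h) (-V act (ε ⁻¹) w)) +V act ((ε ∙ h) ∙ ε ⁻¹) (-V act (h ⁻¹) 0V)
        ≈⟨ V.∙-cong (V.∙-cong (V.∙-congˡ {x = w} (act-0 ε))
                               (act-cong (G.identityˡ h) (V.⁻¹-cong ε⁻¹-acts-trivially)))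
                    (vanishes ((ε ∙ h) ∙ ε ⁻¹)) ⟩
      ((w +V 0V) +V act h (-V w)) +V 0V  ≈⟨ V.identityʳ _ ⟩
      (w +V 0V) +V act h (-V w)          ≈⟨ V.∙-cong (V.identityʳ w) (act-neg h w) ⟩
      w +V (-V act h w)                  ∎

  module Commutators {n} (order : HasOrder G' n) (coprime : Coprime n p) where
    open OrbitSum linear order
    open Enumeration G' order
    open SetoidReasoning V.setoid
    private
      module orbitSum = IsGroupHomomorphism orbitSum-isGroupHomomorphism

    φ : Elem → Vec2
    φ x = orbitSum (proj₁ x)

    φ-∙G : ∀ x y → φ (x ∙G y) ≃ φ x +V φ y
    φ-∙G (v , g) (w , h) = begin
      orbitSum (v +V act g w)          ≈⟨ orbitSum.homo v (act g w) ⟩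
      orbitSum v +V orbitSum (act g w) ≈⟨ V.∙-congˡ {x = orbitSum v} (orbitSum-act g w) ⟩
      orbitSum v +V orbitSum w         ∎

    φ-⁻¹G : ∀ x → φ (x ⁻¹G) ≃ -V φ x
    φ-⁻¹G (v , g) = begin
      orbitSum (-V act (g ⁻¹) v)       ≈⟨ orbitSum.⁻¹-homo (act (g ⁻¹) v) ⟩
      -V orbitSum (act (g ⁻¹) v)       ≈⟨ V.⁻¹-cong (orbitSum-act (g ⁻¹) v) ⟩
      -V orbitSum v                    ∎

    φ-commutator : ∀ s g → φ (commutator s g) ≃ 0V
    φ-commutator s g = begin
      φ (commutator s g)                      ≈⟨ φ-∙G ((s ∙G g) ∙G (s ⁻¹G)) (g ⁻¹G) ⟩
      φ ((s ∙G g) ∙G (s ⁻¹G)) +V φ (g ⁻¹G)    ≈⟨ V.∙-cong (φ-∙G (s ∙G g) (s ⁻¹G)) (φ-⁻¹G g) ⟩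
      (φ (s ∙G g) +V φ (s ⁻¹G)) +V (-V φ g)   ≈⟨ V.∙-congʳ (V.∙-cong (φ-∙G s g) (φ-⁻¹G s)) ⟩
      ((φ s +V φ g) +V (-V φ s)) +V (-V φ g)  ≈⟨ V.∙-congʳ (VP.xyx⁻¹≈y (φ s) (φ g)) ⟩
      φ g +V (-V φ g)                         ≈⟨ V.inverseʳ (φ g) ⟩
      0V                                      ∎

    Gen-commutator⇒φ≃0 : ∀ {x} → Gen IsComm x → φ x ≃ 0V
    Gen-commutator⇒φ≃0 (gen (s , g , _ , x≈[s,g])) =
      V.trans (orbitSum.⟦⟧-cong (≈G⇒≃ _ (commutator s g) x≈[s,g])) (φ-commutator s g)
    Gen-commutator⇒φ≃0 one = orbitSum.ε-homo
    Gen-commutator⇒φ≃0 (mul {x} {y} x∈ y∈) = begin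
      φ (x ∙G y)    ≈⟨ φ-∙G x y ⟩
      φ x +V φ y    ≈⟨ V.∙-cong (Gen-commutator⇒φ≃0 x∈) (Gen-commutator⇒φ≃0 y∈) ⟩
      0V +V 0V      ≈⟨ V.identityˡ 0V ⟩
      0V            ∎
    Gen-commutator⇒φ≃0 (inv {x} x∈) = begin
      φ (x ⁻¹G)     ≈⟨ φ-⁻¹G x ⟩
      -V φ x        ≈⟨ V.⁻¹-cong (Gen-commutator⇒φ≃0 x∈) ⟩
      -V 0V         ≈⟨ VP.ε⁻¹≈ε ⟩
      0V            ∎
    Gen-commutator⇒φ≃0 (resp {x} {y} x≈y x∈) =
      V.trans (orbitSum.⟦⟧-cong (V.sym (≈G⇒≃ x y x≈y))) (Gen-commutator⇒φ≃0 x∈)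

    spanned-by-commutators : CondB → ∀ v → Gen IsComm (v , ε)
    spanned-by-commutators B v =
      resp (≈G-intro sum≃v G.refl) (Gen-∑ difference (λ i → gen (difference-commutator w (enumerate i))))
      where
      w : Vec2
      w = proj₁ (·V-surjective coprime v)

      difference : Fin n → Vec2
      difference i = w +V (-V act (enumerate i) w)

      orbitSum≃0 : orbitSum w ≃ 0V
      orbitSum≃0 = ≈V⇒≃ (B (orbitSum w) (λ g → ≃⇒≈V (act-orbitSum g w)))

      sum≃v : ∑[ i < n ] difference i ≃ v
      sum≃v = begin
        ∑[ i < n ] difference i
          ≈⟨ V.identityʳ _ ⟨
        (∑[ i < n ] difference i) +V 0V
          ≈⟨ V.∙-congˡ {x = ∑[ i < n ] difference i} (V.sym orbitSum≃0) ⟩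
        (∑[ i < n ] difference i) +V orbitSum w
          ≈⟨ ∑-distrib-+ difference (λ i → act (enumerate i) w) ⟨
        ∑[ i < n ] (difference i +V act (enumerate i) w)
          ≈⟨ sum-cong-≋ (λ i → VP.//-rightDividesˡ (act (enumerate i) w) w) ⟩
        ∑[ i < n ] w
          ≈⟨ ∑-const n w ⟩
        (+ n) ·V w
          ≈⟨ proj₂ (·V-surjective coprime v) ⟩
        v ∎

    CondB⇔Condb : CondB ⇔ Condb
    CondB⇔Condb = mk⇔ CondB⇒Condb Condb⇒CondB
      where
      CondB⇒Condb : CondB → Condb
      CondB⇒Condb B (v , g) =
          (λ g≈ε → resp (≈G-intro (V.refl {v}) (G.sym g≈ε)) (spanned-by-commutators B v))
        , Gen-commutator⇒InSp

      Condb⇒CondB : Condb → CondB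
      Condb⇒CondB b v fixed = ≃⇒≈V (·V-cancel coprime (begin
        (+ n) ·V v        ≈⟨ ∑-const n v ⟨
        ∑[ i < n ] v      ≈⟨ orbitSum-fixed v (λ g → ≈V⇒≃ (fixed g)) ⟨
        orbitSum v        ≈⟨ Gen-commutator⇒φ≃0 (proj₁ (b (v , ε)) G.refl) ⟩
        0V                ∎))

  FixesL : C → Set
  FixesL h = ∀ v → InL v → act h v ≈V v

  InL-resp : ∀ {u v} → u ≃ v → InL u → InL v
  InL-resp u≃v (k , u≈kl) = k , ≃⇒≈V (V.trans (V.sym u≃v) (≈V⇒≃ u≈kl))

  fixes⇒stabilizes : ∀ {h} → FixesL h → Stabilizes h
  fixes⇒stabilizes {h} fixes = (λ v v∈L → InL-resp (V.sym (≈V⇒≃ {act h v} {v} (fixes v v∈L))) v∈L)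
                             , (λ w w∈L → w , w∈L , fixes w w∈L)

  conjugate : Elem → Elem → Elem
  conjugate g k = (g ∙G k) ∙G (g ⁻¹G)

  conjugate-translation : ∀ w h u {g} → g ≈ᴳ ε → proj₁ (conjugate (w , h) (u , g)) ≃ act h u
  conjugate-translation w h u {g} g≈ε = begin
    (w +V act h u) +V act (h ∙ g) (-V act (h ⁻¹) w)  ≈⟨ V.∙-congˡ {x = w +V act h u} translate-back ⟩
    (w +V act h u) +V (-V w)                         ≈⟨ VP.xyx⁻¹≈y w (act h u) ⟩
    act h u                                          ∎
    where
    open SetoidReasoning V.setoid
    translate-back : act (h ∙ g) (-V act (h ⁻¹) w) ≃ -V w
    translate-back = begin
      act (h ∙ g) (-V act (h ⁻¹) w)  ≈⟨ act-congˡ (-V act (h ⁻¹) w) (G.trans (G.∙-congˡ g≈ε) (G.identityʳ h)) ⟩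
      act h (-V act (h ⁻¹) w)        ≈⟨ act-neg h (act (h ⁻¹) w) ⟩
      -V act h (act (h ⁻¹) w)        ≈⟨ V.⁻¹-cong (act-cancel h w) ⟩
      -V w                           ∎

  conjugate-InSp : ∀ w h u {g} → g ≈ᴳ ε → conjugate (w , h) (u , g) ≈G (act h u , ε)
  conjugate-InSp w h u {g} g≈ε = ≈G-intro (conjugate-translation w h u g≈ε)
    (G.trans (G.∙-congʳ (G.trans (G.∙-congˡ g≈ε) (G.identityʳ h))) (G.inverseʳ h))

  module Normalizers {q} (H' : C → Set q) (subgroup : IsSubgroup G' H') where
    open IsSubgroup subgroup using (ε∈)

    InK-intro : ∀ u → InL u → InK H' (u , ε)
    InK-intro u u∈L = G.refl , u∈L , ε∈

    InK-resp : ∀ x y → x ≈G y → InK H' x → InK H' y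
    InK-resp x y x≈y (x∈Sp , x∈L , x∈H') =
      G.trans (G.sym (proj₂ x≈y)) x∈Sp , InL-resp (≈G⇒≃ x y x≈y) x∈L , IsSubgroup.resp subgroup (proj₂ x≈y) x∈H'

    normalizes⇔stabilizes : ∀ w h → InN H' (w , h) ⇔ Stabilizes h
    normalizes⇔stabilizes w h = mk⇔ normalizes⇒stabilizes stabilizes⇒normalizes
      where
      normalizes⇒stabilizes : InN H' (w , h) → Stabilizes h
      normalizes⇒stabilizes (into , onto) = maps-into , maps-onto
        where
        maps-into : ∀ v → InL v → InL (act h v)
        maps-into v v∈L = proj₁ (proj₂ (InK-resp (conjugate (w , h) (v , ε)) (act h v , ε)
                                          (conjugate-InSp w h v G.refl) (into (v , ε) (InK-intro v v∈L))))

        maps-onto : ∀ v → InL v → ∃[ u ] (InL u × act h u ≈V v)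
        maps-onto v v∈L with onto (v , ε) (InK-intro v v∈L)
        ... | (u , g) , (g≈ε , u∈L , _) , conj≈v = u , u∈L ,
          ≃⇒≈V (V.trans (V.sym (conjugate-translation w h u g≈ε))
                        (≈G⇒≃ (conjugate (w , h) (u , g)) (v , ε) conj≈v))

      stabilizes⇒normalizes : Stabilizes h → InN H' (w , h)
      stabilizes⇒normalizes (maps-into , maps-onto) = into , onto
        where
        into : ∀ k → InK H' k → InK H' (conjugate (w , h) k)
        into (u , g) (g≈ε , u∈L , _) =
          InK-resp (act h u , ε) (conjugate (w , h) (u , g))
                   (≈G-sym (conjugate (w , h) (u , g)) (act h u , ε) (conjugate-InSp w h u g≈ε))
                   (InK-intro (act h u) (maps-into u u∈L))

        onto : ∀ k → InK H' k → ∃[ k' ] (InK H' k' × conjugate (w , h) k' ≈G k)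
        onto (u , g) (g≈ε , u∈L , _) with maps-onto u u∈L
        ... | v , v∈L , hv≈u = (v , ε) , InK-intro v v∈L ,
          ≈G-intro (V.trans (conjugate-translation w h v G.refl) (≈V⇒≃ hv≈u))
                   (G.trans (proj₂ (conjugate-InSp w h v G.refl)) (G.sym g≈ε))

    centralizes⇔fixes : ∀ w h → InZ H' (w , h) ⇔ FixesL h
    centralizes⇔fixes w h = mk⇔ centralizes⇒fixes fixes⇒centralizes
      where
      open SetoidReasoning V.setoid

      centralizes⇒fixes : InZ H' (w , h) → FixesL h
      centralizes⇒fixes central v v∈L = ≃⇒≈V (VP.∙-cancelˡ w (act h v) v (begin
        w +V act h v  ≈⟨ ≈G⇒≃ ((w , h) ∙G (v , ε)) ((v , ε) ∙G (w , h)) (central (v , ε) (InK-intro v v∈L)) ⟩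
        v +V act ε w  ≈⟨ V.∙-congˡ {x = v} (act-identity w) ⟩
        v +V w        ≈⟨ V.comm v w ⟩
        w +V v        ∎))

      fixes⇒centralizes : FixesL h → InZ H' (w , h)
      fixes⇒centralizes fixes (u , g) (g≈ε , u∈L , _) = ≈G-intro
        (begin
          w +V act h u  ≈⟨ V.∙-congˡ {x = w} (≈V⇒≃ {act h u} {u} (fixes u u∈L)) ⟩
          w +V u        ≈⟨ V.comm w u ⟩
          u +V w        ≈⟨ V.∙-congˡ {x = u} (V.trans (act-congˡ w g≈ε) (act-identity w)) ⟨
          u +V act g w  ∎)
        (G.trans (G.trans (G.∙-congˡ g≈ε) (G.identityʳ h)) (G.sym (G.trans (G.∙-congʳ g≈ε) (G.identityˡ h))))

    CondC⇔Condc : CondC ⇔ Condc H'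
    CondC⇔Condc = mk⇔ CondC⇒Condc Condc⇒CondC
      where
      open Equivalence using (to; from)

      CondC⇒Condc : CondC → Condc H'
      CondC⇒Condc C (w , h) =
          (λ normalizes → from (centralizes⇔fixes w h) (C h (to (normalizes⇔stabilizes w h) normalizes)))
        , (λ centralizes → from (normalizes⇔stabilizes w h)
                             (fixes⇒stabilizes (to (centralizes⇔fixes w h) centralizes)))

      Condc⇒CondC : Condc H' → CondC
      Condc⇒CondC c h stabilizes =
        to (centralizes⇔fixes 0V h) (proj₁ (c (0V , h)) (from (normalizes⇔stabilizes 0V h) stabilizes))

-- Primality of p, l ≉ 0 and the H'-stability of L only serve to make L a line and H a subgroup;
-- the equivalence itself needs just that n is invertible mod p.
proposition5p3 : {c ℓ q : Level} (p : ℕ) → Prime p →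
    (G' : Group c ℓ) → (n : ℕ) → HasOrder G' n → Coprime n p →
    (H' : Group.Carrier G' → Set q) → IsSubgroup G' H' →
    (ρ : Group.Carrier G' → Mat2) → IsRep2 G' p ρ →
    (l : Vec2) → ¬ Fp._≈V_ p l (Fp.0V p) →
    (∀ h → H' h → Setting.Stabilizes G' p ρ l h) →
    (Setting.CondB G' p ρ l × Setting.CondC G' p ρ l)
      ⇔ (Setting.Condb G' p ρ l × Setting.Condc G' p ρ l H')
proposition5p3 p _ G' n order coprime H' subgroup ρ rep l _ _ = CondB⇔Condb ×-⇔ CondC⇔Condc
  where
  open SemidirectProduct G' p rep l
  open Commutators order coprime
  open Normalizers H' subgroup
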